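{- Let $p$ be a prime, $L$ a finite extension of $\mathbf{Q}_p$ with valuation $v_p$ normalised by $v_p(p)=1$, and let $r_1\ge r_2\ge 0$ be integers. Let $\Pi$ and $\Sigma_2$ be as in the context (so $\Pi$ has Hecke parameters $\alpha,\beta,\gamma,\delta\in L$ at $p$ ordered so that $v_p(\alpha)\le v_p(\beta)\le v_p(\gamma)\le v_p(\delta)$, and $\Sigma_2$ has Hecke parameters $\mathfrak{a}_2,\mathfrak{b}_2\in L$ at $p$ and weight $t_2+2$), and suppose that $t_2=r_1-r_2$ (and $t_1=0$). Suppose that $\Pi$ is Klingen-ordinary at $p$, i.e. $v_p(\alpha\beta)=r_2+1$. If one of the eight pairwise products $\lambda\mu$ with $\lambda\in\{\alpha,\beta,\gamma,\delta\}$ and $\mu\in\{\mathfrak{a}_2,\mathfrak{b}_2\}$ is equal to $p^{r_1+2}$, then $\Pi$ is in fact Borel-ordinary at $p$ (i.e. additionally $v_p(\alpha)=0$), $\Sigma_2$ is ordinary at $p$ (i.e. one of $\mathfrak{a}_2,\mathfrak{b}_2$ is a $p$-adic unit), and, labelling $\mathfrak{a}_2,\mathfrak{b}_2$ so that $\mathfrak{a}_2$ is the $p$-adic unit, the product equal to $p^{r_1+2}$ is $\beta\mathfrak{b}_2$ or $\gamma\mathfrak{a}_2$ (or both).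
   Context: $\Pi$ is a non-endoscopic, non-CAP cuspidal automorphic representation of $\mathrm{GSp}_4(\mathbf{A}_{\mathbf{Q}})$ whose generic member is discrete series at $\infty$ of weight $(r_1+3,r_2+3)$, unramified at $p$, with central character attached to a Dirichlet character $\chi_\Pi$. The Hecke parameters $\alpha,\beta,\gamma,\delta$ of $\Pi$ at $p$ are the Hecke parameters of the twist $\Pi_p\otimes\|\cdot\|^{ -(r_1+r_2)/2}$; they are algebraic integers (embedded in $L$), all of complex absolute value $p^{(r_1+r_2+3)/2}$, satisfying $\alpha\delta=\beta\gamma=p^{r_1+r_2+3}\chi_\Pi(p)$ with $\chi_\Pi(p)$ a root of unity, and (with the ordering by valuation) $v_p(\alpha)\ge 0$ and $v_p(\alpha\beta)\ge r_2+1$. $\Pi$ is called Siegel-ordinary at $p$ if $v_p(\alpha)=0$, Klingen-ordinary if $v_p(\alpha\beta)=r_2+1$, and Borel-ordinary if both hold. $\Sigma_2$ is a cuspidal automorphic representation of $\mathrm{GL}_2(\mathbf{A}_{\mathbf{Q}})$ generated by a holomorphic cuspidal newform $g_2$ of weight $t_2+2\ge 2$ and nebentype $\chi_{\Sigma_2}$, unramified at $p$; its Hecke parameters $\mathfrak{a}_2,\mathfrak{b}_2$ at $p$ (those of $\Sigma_{2,p}\otimes\|\cdot\|^{ -t_2/2}$) are algebraic integers (embedded in $L$) of complex absolute value $p^{(t_2+1)/2}$ with $\mathfrak{a}_2+\mathfrak{b}_2=a_p(g_2)$ and $\mathfrak{a}_2\mathfrak{b}_2=p^{t_2+1}\chi_{\Sigma_2}(p)$.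 $\Sigma_2$ is ordinary at $p$ if one of $\mathfrak{a}_2,\mathfrak{b}_2$ is a $p$-adic unit. -}

module Defs where

open import Level using (Level; _⊔_)
open import Algebra.Bundles using (CommutativeRing)
open import Data.Nat using (ℕ; zero; suc)
import Data.Nat as ℕ
open import Data.Integer using (+_)
open import Data.Rational using (ℚ; _≤_; 0ℚ; 1ℚ; _/_) renaming (_+_ to _+ℚ_)
open import Data.Sum using (_⊎_)
open import Data.Product using (Σ; _×_; ∃)
open import Relation.Nullary using (¬_)
open import Relation.Binary.PropositionalEquality using (_≡_)

ℕtoℚ : ℕ → ℚ
ℕtoℚ n = (+ n) / 1

module RingOps {c ℓ : Level} (R : CommutativeRing c ℓ) where
  open CommutativeRing R
  embℕ : ℕ → Carrier
  embℕ zero = 0#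
  embℕ (suc n) = 1# + embℕ n
  pow : Carrier → ℕ → Carrier
  pow x zero = 1#
  pow x (suc n) = x * pow x n

-- This abstracts
-- "a finite extension L of Q_p with v_p normalised by v_p(p) = 1".
-- The value of v at 0 is irrelevant (junk); all axioms are stated for nonzero arguments.
record PAdicValuedField (c ℓ : Level) (p : ℕ) : Set (Level.suc (c ⊔ ℓ)) where
  field
    cring : CommutativeRing c ℓ
  open CommutativeRing cring public
  open RingOps cring public
  field
    1≉0      : ¬ (1# ≈ 0#)
    inverse  : ∀ x → ¬ (x ≈ 0#) → Σ Carrier λ y → x * y ≈ 1#
    char0    : ∀ n → ¬ (embℕ (suc n) ≈ 0#)
    v        : Carrier → ℚ
    v-cong   : ∀ {x y} → x ≈ y → v x ≡ v y
    v-one    : v 1# ≡ 0ℚ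
    v-mul    : ∀ x y → ¬ (x ≈ 0#) → ¬ (y ≈ 0#) → v (x * y) ≡ v x +ℚ v y
    v-ultra  : ∀ x y → ¬ (x ≈ 0#) → ¬ (y ≈ 0#) → ¬ ((x + y) ≈ 0#) →
               (v x ≤ v (x + y)) ⊎ (v y ≤ v (x + y))
    v-p      : v (embℕ p) ≡ 1ℚ

  P : Carrier
  P = embℕ p

  P^ : ℕ → Carrier
  P^ n = pow P n

  RootOfUnity : Carrier → Set ℓ
  RootOfUnity ζ = Σ ℕ λ n → pow ζ (suc n) ≈ 1#

-- Taking valuations turns the hypotheses into linear relations between the slopes
-- a ≤ b ≤ c ≤ d of α, β, γ, δ and μ, ν of 𝔞₂, 𝔟₂ (roots of unity have valuation 0):
-- a + d = b + c = (r₁ + 2) + (r₂ + 1), a + b = r₂ + 1 and μ + ν = t₂ + 1, so that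
-- r₁ + 2 = (a + b) + (μ + ν).  Hence λ𝔞₂ = p^(r₁+2) (the case of 𝔟₂ is symmetric) forces
-- b + ν = 0 for λ = α, a + ν = 0 for β, a + μ = 0 for γ and b + μ = 0 for δ.  All slopes are
-- non-negative, and b = 0 is impossible since a ≤ b and a + b = r₂ + 1 > 0; so only β and γ
-- remain, and they force a = 0 together with the vanishing of the other slope of Σ₂.
module Submission where

open import Defs
open import Level using (Level)
open import Data.Nat using (ℕ)

module NatToRational where

  open import Data.Nat using (suc)
  import Data.Nat as ℕ
  open import Data.Nat.Coprimality using (1-coprimeTo)
  import Data.Nat.Coprimality as Coprime
  open import Data.Integer using (+_)
  import Data.Integer as ℤ
  import Data.Integer.Properties as ℤ
  open import Data.Rational using (0ℚ; mkℚ; _+_; _<_; _/_)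
  open import Data.Rational.Properties using (normalize-coprime; normalize-pos; positive⁻¹)
  open import Relation.Binary.PropositionalEquality using (_≡_; refl; sym; cong₂)

  ℕtoℚ≡mkℚ : ∀ n → ℕtoℚ n ≡ mkℚ (+ n) 0 (Coprime.sym (1-coprimeTo n))
  ℕtoℚ≡mkℚ n = normalize-coprime (Coprime.sym (1-coprimeTo n))

  ℕtoℚ-+ : ∀ m n → ℕtoℚ (m ℕ.+ n) ≡ ℕtoℚ m + ℕtoℚ n
  ℕtoℚ-+ m n rewrite ℕtoℚ≡mkℚ m | ℕtoℚ≡mkℚ n =
    sym (cong₂ (λ x y → (x ℤ.+ y) / 1) (ℤ.*-identityʳ (+ m)) (ℤ.*-identityʳ (+ n)))

  ℕtoℚ-sum : ∀ m n {k} → m ℕ.+ n ≡ k → ℕtoℚ m + ℕtoℚ n ≡ ℕtoℚ k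
  ℕtoℚ-sum m n refl = sym (ℕtoℚ-+ m n)

  ℕtoℚ-pos : ∀ {n} → 0 ℕ.< n → 0ℚ < ℕtoℚ n
  ℕtoℚ-pos {suc n} _ = positive⁻¹ (ℕtoℚ (suc n)) {{normalize-pos (suc n) 1}}

module RationalArithmetic where

  open import Data.Rational using (ℚ; 0ℚ; 1ℚ; NonZero; _+_; _-_; _*_; 1/_; _≤_; _<_)
  open import Data.Rational.Properties
  open import Data.Rational.Solver using (module +-*-Solver)
  open import Data.Fin using (Fin)
  open import Data.Fin.Patterns using (0F; 1F; 2F; 3F)
  open import Data.Product using (Σ; _×_; _,_; proj₁; proj₂; swap)
  open import Data.Sum using (_⊎_; inj₁; inj₂)
  open import Data.Empty using (⊥; ⊥-elim)
  open import Relation.Binary.PropositionalEquality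
  open +-*-Solver using (solve; _:=_; _:+_; _:-_)

  nonNeg+nonNeg≡0 : ∀ {x y} → 0ℚ ≤ x → 0ℚ ≤ y → x + y ≡ 0ℚ → x ≡ 0ℚ × y ≡ 0ℚ
  nonNeg+nonNeg≡0 {x} {y} 0≤x 0≤y x+y≡0 =
    ≤-antisym (subst (x ≤_) x+y≡0 (subst (_≤ x + y) (+-identityʳ x) (+-monoʳ-≤ x 0≤y))) 0≤x ,
    ≤-antisym (subst (y ≤_) x+y≡0 (subst (_≤ x + y) (+-identityˡ y) (+-monoˡ-≤ y 0≤x))) 0≤y

  complementary-sum≡0 : ∀ x y z w {s t} →
    x + y ≡ s → z + w ≡ t → x + z ≡ s + t → y + w ≡ 0ℚ
  complementary-sum≡0 x y z w {s} {t} x+y≡s z+w≡t x+z≡s+t = begin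
    y + w                         ≡⟨ solve 4 (λ x y z w → y :+ w := ((x :+ y) :+ (z :+ w)) :- (x :+ z)) refl x y z w ⟩
    ((x + y) + (z + w)) - (x + z) ≡⟨ cong₂ _-_ (cong₂ _+_ x+y≡s z+w≡t) x+z≡s+t ⟩
    (s + t) - (s + t)             ≡⟨ +-inverseʳ (s + t) ⟩
    0ℚ                            ∎
    where open ≡-Reasoning

  *-cancelˡ-≡0 : ∀ r .{{_ : NonZero r}} {x} → r * x ≡ 0ℚ → x ≡ 0ℚ
  *-cancelˡ-≡0 r {x} rx≡0 = begin
    x               ≡⟨ sym (*-identityˡ x) ⟩
    1ℚ * x          ≡⟨ cong (_* x) (sym (*-inverseˡ r)) ⟩
    (1/ r * r) * x  ≡⟨ *-assoc (1/ r) r x ⟩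
    1/ r * (r * x)  ≡⟨ cong (1/ r *_) rx≡0 ⟩
    1/ r * 0ℚ       ≡⟨ *-zeroʳ (1/ r) ⟩
    0ℚ              ∎
    where open ≡-Reasoning

  -- s and t are the slopes of (α, β, γ, δ) and (𝔞₂, 𝔟₂); ρ, τ, κ, σ stand for
  -- r₂ + 1, t₂ + 1, r₁ + 2 and r₁ + r₂ + 3.
  module SlopeCases
    {ρ τ κ σ : ℚ} (s : Fin 4 → ℚ) (t : Fin 2 → ℚ)
    (0<ρ : 0ℚ < ρ) (0≤s₀ : 0ℚ ≤ s 0F) (s₀≤s₁ : s 0F ≤ s 1F) (0≤t₀ : 0ℚ ≤ t 0F) (0≤t₁ : 0ℚ ≤ t 1F)
    (s₀+s₁≡ρ : s 0F + s 1F ≡ ρ) (t₀+t₁≡τ : t 0F + t 1F ≡ τ) (ρ+τ≡κ : ρ + τ ≡ κ) (κ+ρ≡σ : κ + ρ ≡ σ)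
    (s₀+s₃≡σ : s 0F + s 3F ≡ σ) (s₁+s₂≡σ : s 1F + s 2F ≡ σ)
    where

    s₁≢0 : s 1F ≢ 0ℚ
    s₁≢0 s₁≡0 = <⇒≢ 0<ρ (begin
      0ℚ          ≡⟨ sym (+-identityʳ 0ℚ) ⟩
      0ℚ + 0ℚ     ≡⟨ cong₂ _+_ (sym s₀≡0) (sym s₁≡0) ⟩
      s 0F + s 1F ≡⟨ s₀+s₁≡ρ ⟩
      ρ           ∎)
      where
      open ≡-Reasoning
      s₀≡0 : s 0F ≡ 0ℚ
      s₀≡0 = ≤-antisym (subst (s 0F ≤_) s₁≡0 s₀≤s₁) 0≤s₀

    0≤s₁ : 0ℚ ≤ s 1F
    0≤s₁ = ≤-trans 0≤s₀ s₀≤s₁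

    s₁+s₀≡ρ : s 1F + s 0F ≡ ρ
    s₁+s₀≡ρ = trans (+-comm (s 1F) (s 0F)) s₀+s₁≡ρ

    s₂+s₁≡κ+ρ : s 2F + s 1F ≡ κ + ρ
    s₂+s₁≡κ+ρ = trans (+-comm (s 2F) (s 1F)) (trans s₁+s₂≡σ (sym κ+ρ≡σ))

    s₃+s₀≡κ+ρ : s 3F + s 0F ≡ κ + ρ
    s₃+s₀≡κ+ρ = trans (+-comm (s 3F) (s 0F)) (trans s₀+s₃≡σ (sym κ+ρ≡σ))

    module _ {μ ν : ℚ} (0≤μ : 0ℚ ≤ μ) (0≤ν : 0ℚ ≤ ν) (μ+ν≡τ : μ + ν ≡ τ) where

      s₀-case : s 0F + μ ≡ κ → ⊥
      s₀-case s₀+μ≡κ = s₁≢0 (proj₁ (nonNeg+nonNeg≡0 0≤s₁ 0≤ν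
        (complementary-sum≡0 (s 0F) (s 1F) μ ν s₀+s₁≡ρ μ+ν≡τ (trans s₀+μ≡κ (sym ρ+τ≡κ)))))

      s₁-case : s 1F + μ ≡ κ → s 0F ≡ 0ℚ × ν ≡ 0ℚ
      s₁-case s₁+μ≡κ = nonNeg+nonNeg≡0 0≤s₀ 0≤ν
        (complementary-sum≡0 (s 1F) (s 0F) μ ν s₁+s₀≡ρ μ+ν≡τ (trans s₁+μ≡κ (sym ρ+τ≡κ)))

      s₂-case : s 2F + μ ≡ κ → s 0F ≡ 0ℚ × μ ≡ 0ℚ
      s₂-case s₂+μ≡κ = swap (nonNeg+nonNeg≡0 0≤μ 0≤s₀
        (complementary-sum≡0 (s 2F) μ (s 1F) (s 0F) s₂+μ≡κ s₁+s₀≡ρ s₂+s₁≡κ+ρ))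

      s₃-case : s 3F + μ ≡ κ → ⊥
      s₃-case s₃+μ≡κ = s₁≢0 (proj₂ (nonNeg+nonNeg≡0 0≤μ 0≤s₁
        (complementary-sum≡0 (s 3F) μ (s 0F) (s 1F) s₃+μ≡κ s₀+s₁≡ρ s₃+s₀≡κ+ρ)))

    t₁+t₀≡τ : t 1F + t 0F ≡ τ
    t₁+t₀≡τ = trans (+-comm (t 1F) (t 0F)) t₀+t₁≡τ

    classify : ∀ i j → s i + t j ≡ κ →
      s 0F ≡ 0ℚ × Σ (Fin 2) λ u → Σ (Fin 2) λ w → u ≢ w × t u ≡ 0ℚ ×
        ((i ≡ 1F × j ≡ w) ⊎ (i ≡ 2F × j ≡ u))
    classify 0F 0F e = ⊥-elim (s₀-case 0≤t₀ 0≤t₁ t₀+t₁≡τ e)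
    classify 0F 1F e = ⊥-elim (s₀-case 0≤t₁ 0≤t₀ t₁+t₀≡τ e)
    classify 1F 0F e = let s₀≡0 , t₁≡0 = s₁-case 0≤t₀ 0≤t₁ t₀+t₁≡τ e
                       in  s₀≡0 , 1F , 0F , (λ ()) , t₁≡0 , inj₁ (refl , refl)
    classify 1F 1F e = let s₀≡0 , t₀≡0 = s₁-case 0≤t₁ 0≤t₀ t₁+t₀≡τ e
                       in  s₀≡0 , 0F , 1F , (λ ()) , t₀≡0 , inj₁ (refl , refl)
    classify 2F 0F e = let s₀≡0 , t₀≡0 = s₂-case 0≤t₀ 0≤t₁ t₀+t₁≡τ e
                       in  s₀≡0 , 0F , 1F , (λ ()) , t₀≡0 , inj₂ (refl , refl)
    classify 2F 1F e = let s₀≡0 , t₁≡0 = s₂-case 0≤t₁ 0≤t₀ t₁+t₀≡τ e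
                       in  s₀≡0 , 1F , 0F , (λ ()) , t₁≡0 , inj₂ (refl , refl)
    classify 3F 0F e = ⊥-elim (s₃-case 0≤t₀ 0≤t₁ t₀+t₁≡τ e)
    classify 3F 1F e = ⊥-elim (s₃-case 0≤t₁ 0≤t₀ t₁+t₀≡τ e)

module Valuation {c ℓ : Level} {p : ℕ} (L : PAdicValuedField c ℓ p) where

  open import Data.Nat using (zero; suc; pred)
  open import Data.Nat.Properties using (suc-pred)
  open import Data.Nat.Primality using (Prime; prime⇒nonZero)
  open import Data.Rational using (0ℚ; 1ℚ) renaming (_+_ to _+ℚ_; _*_ to _*ℚ_)
  import Data.Rational.Properties as ℚ
  open import Data.Product using (_,_)
  open import Relation.Nullary using (¬_)
  import Relation.Binary.PropositionalEquality as ≡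
  open ≡ using (_≡_)
  open PAdicValuedField L
  open NatToRational using (ℕtoℚ-+)
  open RationalArithmetic using (*-cancelˡ-≡0)

  *-≉0 : ∀ {x y} → ¬ x ≈ 0# → ¬ y ≈ 0# → ¬ x * y ≈ 0#
  *-≉0 {x} {y} x≉0 y≉0 xy≈0 with inverse x x≉0
  ... | x⁻¹ , xx⁻¹≈1 = y≉0 (begin
      y               ≈⟨ sym (*-identityˡ y) ⟩
      1# * y          ≈⟨ *-cong (sym xx⁻¹≈1) refl ⟩
      (x * x⁻¹) * y   ≈⟨ *-cong (*-comm x x⁻¹) refl ⟩
      (x⁻¹ * x) * y   ≈⟨ *-assoc x⁻¹ x y ⟩
      x⁻¹ * (x * y)   ≈⟨ *-cong refl xy≈0 ⟩
      x⁻¹ * 0#        ≈⟨ zeroʳ x⁻¹ ⟩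
      0#              ∎)
    where open import Relation.Binary.Reasoning.Setoid setoid

  pow-≉0 : ∀ {x} n → ¬ x ≈ 0# → ¬ pow x n ≈ 0#
  pow-≉0 zero    _   = 1≉0
  pow-≉0 (suc n) x≉0 = *-≉0 x≉0 (pow-≉0 n x≉0)

  v-*-≈ : ∀ {x y z} → ¬ x ≈ 0# → ¬ y ≈ 0# → x * y ≈ z → v x +ℚ v y ≡ v z
  v-*-≈ {x} {y} x≉0 y≉0 xy≈z = ≡.trans (≡.sym (v-mul x y x≉0 y≉0)) (v-cong xy≈z)

  v-pow : ∀ {x} → ¬ x ≈ 0# → ∀ n → v (pow x n) ≡ ℕtoℚ n *ℚ v x
  v-pow {x} _   zero    = ≡.trans v-one (≡.sym (ℚ.*-zeroˡ (v x)))
  v-pow {x} x≉0 (suc n) = begin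
    v (x * pow x n)            ≡⟨ v-mul x (pow x n) x≉0 (pow-≉0 n x≉0) ⟩
    v x +ℚ v (pow x n)         ≡⟨ ≡.cong₂ _+ℚ_ (≡.sym (ℚ.*-identityˡ (v x))) (v-pow x≉0 n) ⟩
    1ℚ *ℚ v x +ℚ ℕtoℚ n *ℚ v x ≡⟨ ≡.sym (ℚ.*-distribʳ-+ (v x) 1ℚ (ℕtoℚ n)) ⟩
    (1ℚ +ℚ ℕtoℚ n) *ℚ v x      ≡⟨ ≡.cong (_*ℚ v x) (≡.sym (ℕtoℚ-+ 1 n)) ⟩
    ℕtoℚ (suc n) *ℚ v x        ∎
    where open ≡.≡-Reasoning

  rootOfUnity-≉0 : ∀ {ζ} → RootOfUnity ζ → ¬ ζ ≈ 0#
  rootOfUnity-≉0 {ζ} (n , ζⁿ⁺¹≈1) ζ≈0 = 1≉0 (begin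
    1#           ≈⟨ sym ζⁿ⁺¹≈1 ⟩
    ζ * pow ζ n  ≈⟨ *-cong ζ≈0 refl ⟩
    0# * pow ζ n ≈⟨ zeroˡ (pow ζ n) ⟩
    0#           ∎)
    where open import Relation.Binary.Reasoning.Setoid setoid

  v-rootOfUnity : ∀ {ζ} → RootOfUnity ζ → v ζ ≡ 0ℚ
  v-rootOfUnity {ζ} root@(n , ζⁿ⁺¹≈1) = *-cancelˡ-≡0 (ℕtoℚ (suc n))
    {{ℚ.pos⇒nonZero (ℕtoℚ (suc n)) {{ℚ.normalize-pos (suc n) 1}}}}
    (≡.trans (≡.sym (v-pow (rootOfUnity-≉0 root) (suc n))) (≡.trans (v-cong ζⁿ⁺¹≈1) v-one))

  module _ (prime : Prime p) where

    P≉0 : ¬ P ≈ 0#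
    P≉0 P≈0 = char0 (pred p)
      (≡.subst (λ n → embℕ n ≈ 0#) (≡.sym (suc-pred p {{prime⇒nonZero prime}})) P≈0)

    v-P^ : ∀ n → v (P^ n) ≡ ℕtoℚ n
    v-P^ n = ≡.trans (v-pow P≉0 n) (≡.trans (≡.cong (ℕtoℚ n *ℚ_) v-p) (ℚ.*-identityʳ (ℕtoℚ n)))

    v-P^*rootOfUnity : ∀ {ζ} n → RootOfUnity ζ → v (P^ n * ζ) ≡ ℕtoℚ n
    v-P^*rootOfUnity {ζ} n root = begin
      v (P^ n * ζ)    ≡⟨ v-mul (P^ n) ζ (pow-≉0 n P≉0) (rootOfUnity-≉0 root) ⟩
      v (P^ n) +ℚ v ζ ≡⟨ ≡.cong₂ _+ℚ_ (v-P^ n) (v-rootOfUnity root) ⟩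
      ℕtoℚ n +ℚ 0ℚ    ≡⟨ ℚ.+-identityʳ (ℕtoℚ n) ⟩
      ℕtoℚ n          ∎
      where open ≡.≡-Reasoning

    v-*-≈P^ : ∀ {x y} n → ¬ x ≈ 0# → ¬ y ≈ 0# → x * y ≈ P^ n → v x +ℚ v y ≡ ℕtoℚ n
    v-*-≈P^ n x≉0 y≉0 xy≈Pⁿ = ≡.trans (v-*-≈ x≉0 y≉0 xy≈Pⁿ) (v-P^ n)

    v-*-≈P^*rootOfUnity : ∀ {x y ζ} n → RootOfUnity ζ →
      ¬ x ≈ 0# → ¬ y ≈ 0# → x * y ≈ P^ n * ζ → v x +ℚ v y ≡ ℕtoℚ n
    v-*-≈P^*rootOfUnity n root x≉0 y≉0 xy≈Pⁿζ =
      ≡.trans (v-*-≈ x≉0 y≉0 xy≈Pⁿζ) (v-P^*rootOfUnity n root)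

open import Data.Nat using (_≤_; _+_; _∸_)
open import Data.Nat.Properties using (m≤n+m; m+[n∸m]≡n)
open import Data.Nat.Tactic.RingSolver using (solve-∀)
open import Data.Nat.Primality using (Prime)
open import Data.Fin using (Fin)
open import Data.Fin.Patterns using (0F; 1F; 2F; 3F)
open import Data.Vec using (Vec; lookup; _∷_; [])
open import Data.Rational using (0ℚ) renaming (_≤_ to _≤ℚ_)
open import Data.Product using (Σ; _×_)
open import Data.Sum using (_⊎_)
open import Relation.Nullary using (¬_)
open import Relation.Binary.PropositionalEquality using (_≡_; refl; sym; trans; cong)
open NatToRational using (ℕtoℚ-sum; ℕtoℚ-pos)
open RationalArithmetic using (module SlopeCases)

weights-split : ∀ {r₁ r₂} → r₂ ≤ r₁ → (r₂ + 1) + (r₁ ∸ r₂ + 1) ≡ r₁ + 2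
weights-split {r₁} {r₂} r₂≤r₁ =
  trans (regroup r₂ (r₁ ∸ r₂)) (cong (_+ 2) (m+[n∸m]≡n r₂≤r₁))
  where
  regroup : ∀ m n → (m + 1) + (n + 1) ≡ (m + n) + 2
  regroup = solve-∀

weights-sum : ∀ r₁ r₂ → (r₁ + 2) + (r₂ + 1) ≡ r₁ + r₂ + 3
weights-sum = solve-∀

mainTheorem1 : {c ℓ : Level} (p : ℕ) → Prime p → (L : PAdicValuedField c ℓ p) →
  let module K = PAdicValuedField L in
  (r₁ r₂ t₂ : ℕ) → r₂ ≤ r₁ → t₂ ≡ r₁ ∸ r₂ →
  -- Hecke parameters of Π at p, and the root of unity χ_Π(p)
  (α β γ δ χΠp : K.Carrier) →
  ¬ (α K.≈ K.0#) → ¬ (β K.≈ K.0#) → ¬ (γ K.≈ K.0#) → ¬ (δ K.≈ K.0#) →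
  0ℚ ≤ℚ K.v α → 0ℚ ≤ℚ K.v β → 0ℚ ≤ℚ K.v γ → 0ℚ ≤ℚ K.v δ →
  K.RootOfUnity χΠp →
  α K.* δ K.≈ K.P^ (r₁ + r₂ + 3) K.* χΠp → β K.* γ K.≈ K.P^ (r₁ + r₂ + 3) K.* χΠp →
  K.v α ≤ℚ K.v β → K.v β ≤ℚ K.v γ → K.v γ ≤ℚ K.v δ →
  -- Hecke parameters of Σ₂ at p, and the root of unity χ_Σ₂(p)
  (𝔞₂ 𝔟₂ χΣp : K.Carrier) →
  ¬ (𝔞₂ K.≈ K.0#) → ¬ (𝔟₂ K.≈ K.0#) →
  0ℚ ≤ℚ K.v 𝔞₂ → 0ℚ ≤ℚ K.v 𝔟₂ →
  K.RootOfUnity χΣp →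
  𝔞₂ K.* 𝔟₂ K.≈ K.P^ (t₂ + 1) K.* χΣp →
  -- Klingen-ordinary
  K.v (α K.* β) ≡ ℕtoℚ (r₂ + 1) →
  -- one of the eight products λμ equals p^(r₁+2)
  let par : Vec K.Carrier 4
      par = α ∷ β ∷ γ ∷ δ ∷ []
      sig : Vec K.Carrier 2
      sig = 𝔞₂ ∷ 𝔟₂ ∷ []
  in
  (i : Fin 4) (j : Fin 2) → lookup par i K.* lookup sig j K.≈ K.P^ (r₁ + 2) →
  -- Borel-ordinary, Σ₂ ordinary, and (with u the index of the unit root,
  -- w the other index) the product is β·(non-unit) or γ·(unit)
  K.v α ≡ 0ℚ ×
  Σ (Fin 2) λ u → Σ (Fin 2) λ w → ¬ (u ≡ w) × K.v (lookup sig u) ≡ 0ℚ ×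
    ((i ≡ Fin.suc Fin.zero × j ≡ w) ⊎ (i ≡ Fin.suc (Fin.suc Fin.zero) × j ≡ u))
mainTheorem1 p prime L r₁ r₂ _ r₂≤r₁ refl α β γ δ _ α≉0 β≉0 γ≉0 δ≉0 0≤vα _ _ _ χΠ-root αδ≈ βγ≈
  vα≤vβ _ _ 𝔞 𝔟 _ 𝔞≉0 𝔟≉0 0≤v𝔞 0≤v𝔟 χΣ-root 𝔞𝔟≈ klingen i j λμ≈ =
    classify i j (v-*-≈P^ prime (r₁ + 2) (Π-parameter≉0 i) (Σ-parameter≉0 j) λμ≈)
  where
  open PAdicValuedField L using (_≈_; 0#; v; v-mul)
  open Valuation L
  open SlopeCases (λ i → v (lookup (α ∷ β ∷ γ ∷ δ ∷ []) i)) (λ j → v (lookup (𝔞 ∷ 𝔟 ∷ []) j))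
    (ℕtoℚ-pos {r₂ + 1} (m≤n+m 1 r₂)) 0≤vα vα≤vβ 0≤v𝔞 0≤v𝔟
    (trans (sym (v-mul α β α≉0 β≉0)) klingen)
    (v-*-≈P^*rootOfUnity prime (r₁ ∸ r₂ + 1) χΣ-root 𝔞≉0 𝔟≉0 𝔞𝔟≈)
    (ℕtoℚ-sum (r₂ + 1) (r₁ ∸ r₂ + 1) (weights-split r₂≤r₁))
    (ℕtoℚ-sum (r₁ + 2) (r₂ + 1) (weights-sum r₁ r₂))
    (v-*-≈P^*rootOfUnity prime (r₁ + r₂ + 3) χΠ-root α≉0 δ≉0 αδ≈)
    (v-*-≈P^*rootOfUnity prime (r₁ + r₂ + 3) χΠ-root β≉0 γ≉0 βγ≈)
  Π-parameter≉0 : ∀ i → ¬ lookup (α ∷ β ∷ γ ∷ δ ∷ []) i ≈ 0#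
  Π-parameter≉0 0F = α≉0
  Π-parameter≉0 1F = β≉0
  Π-parameter≉0 2F = γ≉0
  Π-parameter≉0 3F = δ≉0
  Σ-parameter≉0 : ∀ j → ¬ lookup (𝔞 ∷ 𝔟 ∷ []) j ≈ 0#
  Σ-parameter≉0 0F = 𝔞≉0
  Σ-parameter≉0 1F = 𝔟≉0
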